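{- Let $p$ be a prime, $X_1,\dots,X_6\in\mathbb{P}^2(\mathbb{F}_p)$ with $X_1,\dots,X_4$ in general position, and $\ell$ a line containing $X_5,X_6$ but none of $X_1,\dots,X_4$. Let $Y=X_1X_5\cap X_3X_4$, $X'_5=X_2Y\cap\ell$, $Z=X_2X_6\cap X_3X_4$, $X'_6=X_1Z\cap\ell$. Suppose that no triple $X_i,X_j,X_5$ or $X_i,X_j,X_6$ with $1\le i<j\le4$ is collinear, but that some triple $X_i,X_j,X'_5$ or $X_i,X_j,X'_6$ with $1\le i<j\le4$ is collinear. Then $X'_5\ne X'_6$.
   Context: $PQ$ denotes the line through distinct points $P,Q$ of the projective plane. -}

module Defs where

open import Data.Nat using (ℕ)
open import Data.Integer using (ℤ; +_; _+_; _-_; _*_)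
open import Data.Integer.Divisibility using (_∣_)
open import Data.Product using (Σ; _×_; ∃)
open import Relation.Nullary using (¬_)

-- Model of the projective plane P²(F_p): F_p is represented by ℤ modulo p
-- (congruence mod p), points by triples of integers, not all ≡ 0 (mod p),
-- considered up to multiplication by a scalar that is nonzero mod p.

infix 4 _≡[_]_
_≡[_]_ : ℤ → ℕ → ℤ → Set
a ≡[ p ] b = (+ p) ∣ (a - b)

record Triple : Set where
  constructor ⟨_,_,_⟩
  field
    c₀ c₁ c₂ : ℤ
open Triple public

NonZeroVec : ℕ → Triple → Set
NonZeroVec p v = ¬ ((c₀ v ≡[ p ] + 0) × (c₁ v ≡[ p ] + 0) × (c₂ v ≡[ p ] + 0))

IsPoint : ℕ → Triple → Set
IsPoint = NonZeroVec

-- a line of P²(F_p): coefficients (a,b,c) of a x + b y + c z = 0, nonzero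
IsLine : ℕ → Triple → Set
IsLine = NonZeroVec

SamePoint : ℕ → Triple → Triple → Set
SamePoint p P Q = Σ ℤ λ λ' → ¬ (λ' ≡[ p ] + 0) ×
  ((c₀ P ≡[ p ] (λ' * c₀ Q)) × (c₁ P ≡[ p ] (λ' * c₁ Q)) × (c₂ P ≡[ p ] (λ' * c₂ Q)))

OnLine : ℕ → Triple → Triple → Set
OnLine p P L = ((c₀ L * c₀ P) + (c₁ L * c₁ P) + (c₂ L * c₂ P)) ≡[ p ] + 0

Collinear : ℕ → Triple → Triple → Triple → Set
Collinear p P Q R = Σ Triple λ L → IsLine p L × OnLine p P L × OnLine p Q L × OnLine p R L

{-# OPTIONS --safe #-}
module Submission where

-- Points and lines of P²(F_p) are integer vectors read mod p: incidence is a vanishing dot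
-- product and collinearity a vanishing determinant. All the geometry needed comes from one
-- identity, the Grassmann–Plücker relation between four points and a line, which gives the
-- familiar facts about the line through two distinct points. If X′₅ = X′₆ =: W, then W lies on ℓ,
-- on X₂Y and on X₁Z; chasing each of the six possible collinearities XᵢXⱼW back along these lines
-- puts X₅ or X₆ on a line XᵢXⱼ.

open import Defs
open import Data.Nat using (ℕ)
open import Data.Nat.Primality using (Prime)
open import Data.Fin using (Fin; zero; suc; _<_)
open import Data.Product using (Σ; _×_)
open import Data.Sum using (_⊎_)
open import Relation.Nullary using (¬_)
open import Relation.Binary.PropositionalEquality using (_≢_)

open import Algebra.Bundles using (RawRing)
open import Data.Product using (_,_; proj₁; proj₂)
open import Level using (0ℓ)

-- Written over an arbitrary raw ring so that the same formulas serve over ℤ and, as polynomial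
-- syntax, as input to the ring solver.
module VectorAlgebra (R : RawRing 0ℓ 0ℓ) where
  open RawRing R

  V³ : Set
  V³ = Carrier × Carrier × Carrier

  cross : V³ → V³ → V³
  cross (a₀ , a₁ , a₂) (b₀ , b₁ , b₂) =
    a₁ * b₂ + - (a₂ * b₁) , a₂ * b₀ + - (a₀ * b₂) , a₀ * b₁ + - (a₁ * b₀)

  dot : V³ → V³ → Carrier
  dot (f₀ , f₁ , f₂) (x₀ , x₁ , x₂) = f₀ * x₀ + f₁ * x₁ + f₂ * x₂

  det : V³ → V³ → V³ → Carrier
  det A B C = dot (cross A B) C

  e₀ e₁ e₂ : V³
  e₀ = 1# , 0# , 0#
  e₁ = 0# , 1# , 0#
  e₂ = 0# , 0# , 1#

-- Imported only now: the integer operators share their names with those of RawRing.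
open import Data.Empty using (⊥-elim)
open import Data.Integer using (ℤ; +_; +0; _+_; _-_; _*_; -_; ∣_∣; +-*-rawRing)
open import Data.Integer.Divisibility.Signed
  using (_∣_; _∣?_; ∣ᵤ⇒∣; ∣⇒∣ᵤ; ∣m∣n⇒∣m+n; ∣m∣n⇒∣m-n; ∣m+n∣m⇒∣n; ∣m+n∣n⇒∣m; ∣m⇒∣-m; ∣n⇒∣m*n; ∣m⇒∣m*n)
open import Data.Integer.Properties using (+-identityʳ; neg-involutive; abs-*)
open import Data.Integer.Solver using (module +-*-Solver)
open import Data.Nat using (s≤s; z≤n)
import Data.Nat.Divisibility as Nat
open import Data.Nat.Primality using (euclidsLemma)
open import Data.Sum using (inj₁; inj₂)
open import Relation.Binary.PropositionalEquality using (_≡_; refl; sym; cong; subst)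
open import Relation.Nullary using (Dec; yes; no)
open import Relation.Nullary.Decidable using (_×-dec_)
open +-*-Solver using (solve; _:=_; _:+_; _:-_; _:*_; :-_; con; Polynomial)

polynomials : ℕ → RawRing 0ℓ 0ℓ
polynomials n = record
  { Carrier = Polynomial n ; _≈_ = _≡_ ; _+_ = _:+_ ; _*_ = _:*_ ; -_ = :-_ ; 0# = con +0 ; 1# = con (+ 1) }

module ℤ³ = VectorAlgebra +-*-rawRing
module Poly {n} = VectorAlgebra (polynomials n)

coords : Triple → ℤ³.V³
coords ⟨ x₀ , x₁ , x₂ ⟩ = x₀ , x₁ , x₂

triple : ℤ³.V³ → Triple
triple (x₀ , x₁ , x₂) = ⟨ x₀ , x₁ , x₂ ⟩

cross : Triple → Triple → Triple
cross A B = triple (ℤ³.cross (coords A) (coords B))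

dot : Triple → Triple → ℤ
dot F X = ℤ³.dot (coords F) (coords X)

det : Triple → Triple → Triple → ℤ
det A B C = dot (cross A B) C

e₀ e₁ e₂ : Triple
e₀ = triple ℤ³.e₀
e₁ = triple ℤ³.e₁
e₂ = triple ℤ³.e₂

dot-comm : ∀ F X → dot F X ≡ dot X F
dot-comm ⟨ f₀ , f₁ , f₂ ⟩ ⟨ x₀ , x₁ , x₂ ⟩ =
  solve 6 (λ f₀ f₁ f₂ x₀ x₁ x₂ → Poly.dot (f₀ , f₁ , f₂) (x₀ , x₁ , x₂) := Poly.dot (x₀ , x₁ , x₂) (f₀ , f₁ , f₂))
    refl f₀ f₁ f₂ x₀ x₁ x₂

dot-e₀ : ∀ X → dot e₀ X ≡ c₀ X
dot-e₀ ⟨ x₀ , x₁ , x₂ ⟩ = solve 3 (λ x₀ x₁ x₂ → Poly.dot Poly.e₀ (x₀ , x₁ , x₂) := x₀) refl x₀ x₁ x₂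

dot-e₁ : ∀ X → dot e₁ X ≡ c₁ X
dot-e₁ ⟨ x₀ , x₁ , x₂ ⟩ = solve 3 (λ x₀ x₁ x₂ → Poly.dot Poly.e₁ (x₀ , x₁ , x₂) := x₁) refl x₀ x₁ x₂

dot-e₂ : ∀ X → dot e₂ X ≡ c₂ X
dot-e₂ ⟨ x₀ , x₁ , x₂ ⟩ = solve 3 (λ x₀ x₁ x₂ → Poly.dot Poly.e₂ (x₀ , x₁ , x₂) := x₂) refl x₀ x₁ x₂

dot-sub-scaled : ∀ F P Q λ′ →
  dot F P - λ′ * dot F Q ≡ dot F ⟨ c₀ P - λ′ * c₀ Q , c₁ P - λ′ * c₁ Q , c₂ P - λ′ * c₂ Q ⟩
dot-sub-scaled ⟨ f₀ , f₁ , f₂ ⟩ ⟨ p₀ , p₁ , p₂ ⟩ ⟨ q₀ , q₁ , q₂ ⟩ λ′ =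
  solve 10 (λ f₀ f₁ f₂ p₀ p₁ p₂ q₀ q₁ q₂ λ′ →
    let F = f₀ , f₁ , f₂ in
    Poly.dot F (p₀ , p₁ , p₂) :- λ′ :* Poly.dot F (q₀ , q₁ , q₂)
      := Poly.dot F (p₀ :- λ′ :* q₀ , p₁ :- λ′ :* q₁ , p₂ :- λ′ :* q₂))
    refl f₀ f₁ f₂ p₀ p₁ p₂ q₀ q₁ q₂ λ′

c₁-cross-e₀ : ∀ P → c₁ (cross P e₀) ≡ c₂ P
c₁-cross-e₀ ⟨ p₀ , p₁ , p₂ ⟩ =
  solve 3 (λ p₀ p₁ p₂ → proj₁ (proj₂ (Poly.cross (p₀ , p₁ , p₂) Poly.e₀)) := p₂) refl p₀ p₁ p₂

c₂-cross-e₀ : ∀ P → c₂ (cross P e₀) ≡ - c₁ P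
c₂-cross-e₀ ⟨ p₀ , p₁ , p₂ ⟩ =
  solve 3 (λ p₀ p₁ p₂ → proj₂ (proj₂ (Poly.cross (p₀ , p₁ , p₂) Poly.e₀)) := :- p₁) refl p₀ p₁ p₂

c₂-cross-e₁ : ∀ P → c₂ (cross P e₁) ≡ c₀ P
c₂-cross-e₁ ⟨ p₀ , p₁ , p₂ ⟩ =
  solve 3 (λ p₀ p₁ p₂ → proj₂ (proj₂ (Poly.cross (p₀ , p₁ , p₂) Poly.e₁)) := p₀) refl p₀ p₁ p₂

det-rotate : ∀ A B C → det A B C ≡ det B C A
det-rotate ⟨ a₀ , a₁ , a₂ ⟩ ⟨ b₀ , b₁ , b₂ ⟩ ⟨ c₀ , c₁ , c₂ ⟩ =
  solve 9 (λ a₀ a₁ a₂ b₀ b₁ b₂ c₀ c₁ c₂ →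
    let A = a₀ , a₁ , a₂ ; B = b₀ , b₁ , b₂ ; C = c₀ , c₁ , c₂ in
    Poly.det A B C := Poly.det B C A)
    refl a₀ a₁ a₂ b₀ b₁ b₂ c₀ c₁ c₂

det-swap : ∀ A B C → det A B C ≡ - det B A C
det-swap ⟨ a₀ , a₁ , a₂ ⟩ ⟨ b₀ , b₁ , b₂ ⟩ ⟨ c₀ , c₁ , c₂ ⟩ =
  solve 9 (λ a₀ a₁ a₂ b₀ b₁ b₂ c₀ c₁ c₂ →
    let A = a₀ , a₁ , a₂ ; B = b₀ , b₁ , b₂ ; C = c₀ , c₁ , c₂ in
    Poly.det A B C := :- Poly.det B A C)
    refl a₀ a₁ a₂ b₀ b₁ b₂ c₀ c₁ c₂

det-repeat : ∀ A B → det A B B ≡ +0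
det-repeat ⟨ a₀ , a₁ , a₂ ⟩ ⟨ b₀ , b₁ , b₂ ⟩ =
  solve 6 (λ a₀ a₁ a₂ b₀ b₁ b₂ → Poly.det (a₀ , a₁ , a₂) (b₀ , b₁ , b₂) (b₀ , b₁ , b₂) := con +0)
    refl a₀ a₁ a₂ b₀ b₁ b₂

-- The 4 × 4 determinant with rows (A, F·A), (B, F·B), (C, F·C), (D, F·D) vanishes, its columns being dependent.
grassmann-plücker : ∀ A B C D F →
  det A C D * dot F B - det B C D * dot F A ≡ det A B D * dot F C - det A B C * dot F D
grassmann-plücker ⟨ a₀ , a₁ , a₂ ⟩ ⟨ b₀ , b₁ , b₂ ⟩ ⟨ c₀ , c₁ , c₂ ⟩ ⟨ d₀ , d₁ , d₂ ⟩ ⟨ f₀ , f₁ , f₂ ⟩ =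
  solve 15 (λ a₀ a₁ a₂ b₀ b₁ b₂ c₀ c₁ c₂ d₀ d₁ d₂ f₀ f₁ f₂ →
    let A = a₀ , a₁ , a₂ ; B = b₀ , b₁ , b₂ ; C = c₀ , c₁ , c₂ ; D = d₀ , d₁ , d₂ ; F = f₀ , f₁ , f₂ in
    Poly.det A C D :* Poly.dot F B :- Poly.det B C D :* Poly.dot F A
      := Poly.det A B D :* Poly.dot F C :- Poly.det A B C :* Poly.dot F D)
    refl a₀ a₁ a₂ b₀ b₁ b₂ c₀ c₁ c₂ d₀ d₁ d₂ f₀ f₁ f₂

i₁ i₂ i₃ i₄ : Fin 4
i₁ = zero
i₂ = suc zero
i₃ = suc (suc zero)
i₄ = suc (suc (suc zero))

module ModPrime (p : ℕ) (p-prime : Prime p) where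

  infix 4 _≡0 _≋0

  _≡0 : ℤ → Set
  x ≡0 = + p ∣ x

  _≋0 : Triple → Set
  V ≋0 = c₀ V ≡0 × c₁ V ≡0 × c₂ V ≡0

  ≡0-resp : ∀ {x y} → x ≡ y → y ≡0 → x ≡0
  ≡0-resp refl h = h

  0≡0 : +0 ≡0
  0≡0 = ∣ᵤ⇒∣ (p Nat.∣0)

  +-≡0 : ∀ {x y} → x ≡0 → y ≡0 → x + y ≡0
  +-≡0 = ∣m∣n⇒∣m+n

  sub-≡0 : ∀ {x y} → x ≡0 → y ≡0 → x - y ≡0
  sub-≡0 = ∣m∣n⇒∣m-n

  *ˡ-≡0 : ∀ a {x} → x ≡0 → a * x ≡0
  *ˡ-≡0 = ∣n⇒∣m*n

  *ʳ-≡0 : ∀ {x} b → x ≡0 → x * b ≡0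
  *ʳ-≡0 b = ∣m⇒∣m*n b

  neg-≡0⁻¹ : ∀ {x} → - x ≡0 → x ≡0
  neg-≡0⁻¹ {x} h = ≡0-resp (sym (neg-involutive x)) (∣m⇒∣-m h)

  sub≡0⇒≡0ʳ : ∀ {x y} → x - y ≡0 → x ≡0 → y ≡0
  sub≡0⇒≡0ʳ h hx = neg-≡0⁻¹ (∣m+n∣m⇒∣n h hx)

  sub≡0⇒≡0ˡ : ∀ {x y} → x - y ≡0 → y ≡0 → x ≡0
  sub≡0⇒≡0ˡ h hy = ∣m+n∣n⇒∣m h (∣m⇒∣-m hy)

  _≡0? : ∀ x → Dec (x ≡0)
  x ≡0? = + p ∣? x

  _≋0? : ∀ V → Dec (V ≋0)
  V ≋0? = (c₀ V ≡0?) ×-dec ((c₁ V ≡0?) ×-dec (c₂ V ≡0?))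

  *-≡0⇒≡0 : ∀ a b → a * b ≡0 → a ≡0 ⊎ b ≡0
  *-≡0⇒≡0 a b h with euclidsLemma ∣ a ∣ ∣ b ∣ p-prime (subst (p Nat.∣_) (abs-* a b) (∣⇒∣ᵤ h))
  ... | inj₁ p∣a = inj₁ (∣ᵤ⇒∣ p∣a)
  ... | inj₂ p∣b = inj₂ (∣ᵤ⇒∣ p∣b)

  *-≡0-cancelʳ : ∀ {a b} → a * b ≡0 → ¬ b ≡0 → a ≡0
  *-≡0-cancelʳ {a} {b} h b≢0 with *-≡0⇒≡0 a b h
  ... | inj₁ a≡0 = a≡0
  ... | inj₂ b≡0 = ⊥-elim (b≢0 b≡0)

  *-≡0-cancelˡ : ∀ {a b} → a * b ≡0 → ¬ a ≡0 → b ≡0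
  *-≡0-cancelˡ {a} {b} h a≢0 with *-≡0⇒≡0 a b h
  ... | inj₁ a≡0 = ⊥-elim (a≢0 a≡0)
  ... | inj₂ b≡0 = b≡0

  ≡[p]0⇒≡0 : ∀ {x} → x ≡[ p ] + 0 → x ≡0
  ≡[p]0⇒≡0 {x} h = ≡0-resp (sym (+-identityʳ x)) (∣ᵤ⇒∣ h)

  ≡0⇒≡[p]0 : ∀ {x} → x ≡0 → x ≡[ p ] + 0
  ≡0⇒≡[p]0 {x} h = ∣⇒∣ᵤ (≡0-resp (+-identityʳ x) h)

  nonZero⇒≉0 : ∀ {V} → NonZeroVec p V → ¬ V ≋0
  nonZero⇒≉0 nz (h₀ , h₁ , h₂) = nz (≡0⇒≡[p]0 h₀ , ≡0⇒≡[p]0 h₁ , ≡0⇒≡[p]0 h₂)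

  ≉0⇒nonZero : ∀ {V} → ¬ V ≋0 → NonZeroVec p V
  ≉0⇒nonZero nz (h₀ , h₁ , h₂) = nz (≡[p]0⇒≡0 h₀ , ≡[p]0⇒≡0 h₁ , ≡[p]0⇒≡0 h₂)

  dot-≋0ʳ : ∀ F {V} → V ≋0 → dot F V ≡0
  dot-≋0ʳ F (h₀ , h₁ , h₂) = +-≡0 (+-≡0 (*ˡ-≡0 (c₀ F) h₀) (*ˡ-≡0 (c₁ F) h₁)) (*ˡ-≡0 (c₂ F) h₂)

  -- Test against the unit vectors: some coordinate of B is nonzero.
  annihilator-≡0 : ∀ {B c} → NonZeroVec p B → (∀ G → c * dot G B ≡0) → c ≡0
  annihilator-≡0 {B} {c} nz h
    with *-≡0⇒≡0 c (c₀ B) (on e₀ (dot-e₀ B))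
       | *-≡0⇒≡0 c (c₁ B) (on e₁ (dot-e₁ B))
       | *-≡0⇒≡0 c (c₂ B) (on e₂ (dot-e₂ B))
    where
      on : ∀ {b} G → dot G B ≡ b → c * b ≡0
      on G eq = ≡0-resp (cong (c *_) (sym eq)) (h G)
  ... | inj₁ c≡0 | _         | _         = c≡0
  ... | inj₂ _   | inj₁ c≡0  | _         = c≡0
  ... | inj₂ _   | inj₂ _    | inj₁ c≡0  = c≡0
  ... | inj₂ b₀  | inj₂ b₁   | inj₂ b₂   = ⊥-elim (nonZero⇒≉0 nz (b₀ , b₁ , b₂))

  det-≡0-rotate : ∀ A B C → det A B C ≡0 → det B C A ≡0
  det-≡0-rotate A B C = ≡0-resp (sym (det-rotate A B C))

  det-≡0-swap₁₂ : ∀ A B C → det A B C ≡0 → det B A C ≡0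
  det-≡0-swap₁₂ A B C h = neg-≡0⁻¹ (≡0-resp (sym (det-swap A B C)) h)

  det-≡0-swap₂₃ : ∀ A B C → det A B C ≡0 → det A C B ≡0
  det-≡0-swap₂₃ A B C h = det-≡0-rotate B A C (det-≡0-swap₁₂ A B C h)

  det-≡0-parallel : ∀ P E Q → cross P Q ≋0 → det P E Q ≡0
  det-≡0-parallel P E Q h =
    det-≡0-swap₂₃ P Q E (≡0-resp (dot-comm (cross P Q) E) (dot-≋0ʳ E h))

  collinear⇒det≡0 : ∀ P Q R → Collinear p P Q R → det P Q R ≡0
  collinear⇒det≡0 P Q R (L , L≢0 , P∈L , Q∈L , R∈L) = annihilator-≡0 L≢0 λ G →
    ≡0-resp (cong (det P Q R *_) (dot-comm G L))
      (sub≡0⇒≡0ʳ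
        (≡0-resp (sym (grassmann-plücker P Q R G L))
          (sub-≡0 (*ˡ-≡0 (det P R G) (≡[p]0⇒≡0 Q∈L)) (*ˡ-≡0 (det Q R G) (≡[p]0⇒≡0 P∈L))))
        (*ˡ-≡0 (det P Q G) (≡[p]0⇒≡0 R∈L)))

  det-≡0-repeat₂ : ∀ A B → det A B B ≡0
  det-≡0-repeat₂ A B = ≡0-resp (det-repeat A B) 0≡0

  det-≡0-repeat₁ : ∀ A B → det A B A ≡0
  det-≡0-repeat₁ A B = ≡0-resp (det-rotate A B A) (det-≡0-repeat₂ B A)

  cross-unit-≉0 : ∀ P → NonZeroVec p P → Σ Triple λ E → ¬ cross P E ≋0
  cross-unit-≉0 P P≢0 with cross P e₀ ≋0? | cross P e₁ ≋0?
  ... | no P×e₀≉0 | _          = e₀ , P×e₀≉0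
  ... | yes _     | no P×e₁≉0  = e₁ , P×e₁≉0
  ... | yes (_ , h₁ , h₂) | yes (_ , _ , h₂′) = ⊥-elim (nonZero⇒≉0 P≢0
    ( ≡0-resp (sym (c₂-cross-e₁ P)) h₂′
    , neg-≡0⁻¹ (≡0-resp (sym (c₂-cross-e₀ P)) h₂)
    , ≡0-resp (sym (c₁-cross-e₀ P)) h₁ ))

  det≡0⇒collinear : ∀ P Q R → NonZeroVec p P → det P Q R ≡0 → Collinear p P Q R
  det≡0⇒collinear P Q R P≢0 PQR≡0 with cross P Q ≋0? | cross P R ≋0?
  ... | no P×Q≉0 | _ =
    cross P Q , ≉0⇒nonZero P×Q≉0 ,
    ≡0⇒≡[p]0 (det-≡0-repeat₁ P Q) , ≡0⇒≡[p]0 (det-≡0-repeat₂ P Q) , ≡0⇒≡[p]0 PQR≡0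
  ... | yes _ | no P×R≉0 =
    cross P R , ≉0⇒nonZero P×R≉0 ,
    ≡0⇒≡[p]0 (det-≡0-repeat₁ P R) , ≡0⇒≡[p]0 (det-≡0-swap₂₃ P Q R PQR≡0) , ≡0⇒≡[p]0 (det-≡0-repeat₂ P R)
  ... | yes P×Q≋0 | yes P×R≋0 with cross-unit-≉0 P P≢0
  ... | E , P×E≉0 =
    cross P E , ≉0⇒nonZero P×E≉0 ,
    ≡0⇒≡[p]0 (det-≡0-repeat₁ P E) , ≡0⇒≡[p]0 (det-≡0-parallel P E Q P×Q≋0) , ≡0⇒≡[p]0 (det-≡0-parallel P E R P×R≋0)

  exchange : ∀ A B C D → det A B C ≡0 → det A B D ≡0 →
    ∀ F → det A C D * dot F B - det B C D * dot F A ≡0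
  exchange A B C D ABC ABD F =
    ≡0-resp (grassmann-plücker A B C D F) (sub-≡0 (*ʳ-≡0 (dot F C) ABD) (*ʳ-≡0 (dot F D) ABC))

  det-≡0-fourth-triple : ∀ A B C D → NonZeroVec p B →
    det A B C ≡0 → det A B D ≡0 → det B C D ≡0 → det A C D ≡0
  det-≡0-fourth-triple A B C D B≢0 ABC ABD BCD = annihilator-≡0 B≢0 λ G →
    sub≡0⇒≡0ˡ (exchange A B C D ABC ABD G) (*ʳ-≡0 (dot G A) BCD)

  -- The line F separates A from B, so C and D lie on the line AB.
  on-join⇒collinear : ∀ F A B C D → NonZeroVec p B → dot F B ≡0 → ¬ dot F A ≡0 →
    det A B C ≡0 → det A B D ≡0 → det A C D ≡0
  on-join⇒collinear F A B C D B≢0 F∋B F∌A ABC ABD =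
    det-≡0-fourth-triple A B C D B≢0 ABC ABD
      (*-≡0-cancelʳ (sub≡0⇒≡0ʳ (exchange A B C D ABC ABD F) (*ˡ-≡0 (det A C D) F∋B)) F∌A)

  -- B lies on the distinct lines AC and AD, so B = A: every line through B passes through A.
  meet-of-joins : ∀ F A B C D → NonZeroVec p B → det A B C ≡0 → det A B D ≡0 → ¬ det A C D ≡0 →
    dot F B ≡0 → dot F A ≡0
  meet-of-joins F A B C D B≢0 ABC ABD ACD≢0 F∋B =
    *-≡0-cancelˡ (sub≡0⇒≡0ʳ (exchange A B C D ABC ABD F) (*ˡ-≡0 (det A C D) F∋B))
      (λ BCD → ACD≢0 (det-≡0-fourth-triple A B C D B≢0 ABC ABD BCD))

  -- The line AB meets F in both A and B but contains C ∉ F, so A = B.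
  collinear-off-line : ∀ F A B C D → dot F A ≡0 → dot F B ≡0 → ¬ dot F C ≡0 →
    det A B C ≡0 → det A B D ≡0
  collinear-off-line F A B C D F∋A F∋B F∌C ABC = *-≡0-cancelʳ ABD·FC F∌C
    where
      ABD·FC : det A B D * dot F C ≡0
      ABD·FC = sub≡0⇒≡0ˡ
        (≡0-resp (sym (grassmann-plücker A B C D F)) (sub-≡0 (*ˡ-≡0 (det A C D) F∋B) (*ˡ-≡0 (det B C D) F∋A)))
        (*ʳ-≡0 (dot F D) ABC)

  samePoint-incident : ∀ F P Q → SamePoint p P Q → dot F Q ≡0 → dot F P ≡0
  samePoint-incident F P Q (λ′ , _ , h₀ , h₁ , h₂) F∋Q =
    sub≡0⇒≡0ˡ (≡0-resp (dot-sub-scaled F P Q λ′) (dot-≋0ʳ F (∣ᵤ⇒∣ h₀ , ∣ᵤ⇒∣ h₁ , ∣ᵤ⇒∣ h₂))) (*ˡ-≡0 λ′ F∋Q)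

  det-≢0 : ∀ P Q R → NonZeroVec p P → ¬ Collinear p P Q R → ¬ det P Q R ≡0
  det-≢0 P Q R P≢0 ¬PQR PQR≡0 = ¬PQR (det≡0⇒collinear P Q R P≢0 PQR≡0)

  module Configuration
    (X : Fin 4 → Triple) (ℓ X₅ X₆ Y Z W : Triple)
    (X-point : ∀ i → NonZeroVec p (X i))
    (Y-point : NonZeroVec p Y) (Z-point : NonZeroVec p Z) (W-point : NonZeroVec p W)
    (independent : ∀ i j k → i ≢ j → j ≢ k → i ≢ k → ¬ det (X i) (X j) (X k) ≡0)
    (ℓ∌X : ∀ i → ¬ dot ℓ (X i) ≡0) (ℓ∋X₅ : dot ℓ X₅ ≡0) (ℓ∋W : dot ℓ W ≡0)
    (X₅-free : ∀ i j → i < j → ¬ det (X i) (X j) X₅ ≡0)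
    (X₆-free : ∀ i j → i < j → ¬ det (X i) (X j) X₆ ≡0)
    (x₁X₅Y : det (X i₁) X₅ Y ≡0) (x₃x₄Y : det (X i₃) (X i₄) Y ≡0) (x₂YW : det (X i₂) Y W ≡0)
    (x₂X₆Z : det (X i₂) X₆ Z ≡0) (x₃x₄Z : det (X i₃) (X i₄) Z ≡0) (x₁ZW : det (X i₁) Z W ≡0)
    where

    x₁ x₂ x₃ x₄ : Triple
    x₁ = X i₁
    x₂ = X i₂
    x₃ = X i₃
    x₄ = X i₄

    x₂-join-through-W⇒Y : ∀ u → det x₂ u W ≡0 → det x₂ u Y ≡0
    x₂-join-through-W⇒Y u x₂uW =
      on-join⇒collinear ℓ x₂ W u Y W-point ℓ∋W (ℓ∌X i₂) (det-≡0-swap₂₃ x₂ u W x₂uW) (det-≡0-swap₂₃ x₂ Y W x₂YW)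

    x₁-join-through-W⇒Z : ∀ u → det x₁ u W ≡0 → det x₁ u Z ≡0
    x₁-join-through-W⇒Z u x₁uW =
      on-join⇒collinear ℓ x₁ W u Z W-point ℓ∋W (ℓ∌X i₁) (det-≡0-swap₂₃ x₁ u W x₁uW) (det-≡0-swap₂₃ x₁ Z W x₁ZW)

    -- Y lies on the distinct lines u x₂ and u v, so Y = u.
    x₂-join-through-Y⇒x₁X₅ : ∀ u v → det u v Y ≡0 → ¬ det u x₂ v ≡0 → det x₂ u Y ≡0 → det x₁ X₅ u ≡0
    x₂-join-through-Y⇒x₁X₅ u v uvY ux₂v≢0 x₂uY =
      meet-of-joins (cross x₁ X₅) u Y x₂ v Y-point (det-≡0-rotate x₂ u Y x₂uY) (det-≡0-swap₂₃ u v Y uvY) ux₂v≢0 x₁X₅Y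

    x₁-join-through-Z⇒x₂X₆ : ∀ u v → det u v Z ≡0 → ¬ det u x₁ v ≡0 → det x₁ u Z ≡0 → det x₂ X₆ u ≡0
    x₁-join-through-Z⇒x₂X₆ u v uvZ ux₁v≢0 x₁uZ =
      meet-of-joins (cross x₂ X₆) u Z x₁ v Z-point (det-≡0-rotate x₁ u Z x₁uZ) (det-≡0-swap₂₃ u v Z uvZ) ux₁v≢0 x₂X₆Z

    x₂x₃∌Y : ¬ det x₂ x₃ Y ≡0
    x₂x₃∌Y x₂x₃Y = X₅-free i₁ i₃ (s≤s z≤n) (det-≡0-swap₂₃ x₁ X₅ x₃
      (x₂-join-through-Y⇒x₁X₅ x₃ x₄ x₃x₄Y (independent i₃ i₂ i₄ (λ ()) (λ ()) (λ ())) x₂x₃Y))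

    -- Y ∈ x₂W then lies on x₁x₂, and Y ≠ x₁ as Y ∈ x₃x₄, so x₂ and X₅ both lie on x₁Y.
    x₁x₂∌W : ¬ det x₁ x₂ W ≡0
    x₁x₂∌W x₁x₂W = X₅-free i₁ i₂ (s≤s z≤n)
      (on-join⇒collinear (cross x₃ x₄) x₁ Y x₂ X₅ Y-point x₃x₄Y (independent i₃ i₄ i₁ (λ ()) (λ ()) (λ ()))
        (det-≡0-swap₂₃ x₁ x₂ Y (det-≡0-swap₁₂ x₂ x₁ Y (x₂-join-through-W⇒Y x₁ (det-≡0-swap₁₂ x₁ x₂ W x₁x₂W))))
        (det-≡0-swap₂₃ x₁ X₅ Y x₁X₅Y))

    x₁x₃∌W : ¬ det x₁ x₃ W ≡0
    x₁x₃∌W x₁x₃W = X₆-free i₂ i₃ (s≤s (s≤s z≤n)) (det-≡0-swap₂₃ x₂ X₆ x₃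
      (x₁-join-through-Z⇒x₂X₆ x₃ x₄ x₃x₄Z (independent i₃ i₁ i₄ (λ ()) (λ ()) (λ ())) (x₁-join-through-W⇒Z x₃ x₁x₃W)))

    x₁x₄∌W : ¬ det x₁ x₄ W ≡0
    x₁x₄∌W x₁x₄W = X₆-free i₂ i₄ (s≤s (s≤s z≤n)) (det-≡0-swap₂₃ x₂ X₆ x₄
      (x₁-join-through-Z⇒x₂X₆ x₄ x₃ (det-≡0-swap₁₂ x₃ x₄ Z x₃x₄Z) (independent i₄ i₁ i₃ (λ ()) (λ ()) (λ ()))
        (x₁-join-through-W⇒Z x₄ x₁x₄W)))

    x₂x₃∌W : ¬ det x₂ x₃ W ≡0
    x₂x₃∌W x₂x₃W = x₂x₃∌Y (x₂-join-through-W⇒Y x₃ x₂x₃W)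

    x₂x₄∌W : ¬ det x₂ x₄ W ≡0
    x₂x₄∌W x₂x₄W = X₅-free i₁ i₄ (s≤s z≤n) (det-≡0-swap₂₃ x₁ X₅ x₄
      (x₂-join-through-Y⇒x₁X₅ x₄ x₃ (det-≡0-swap₁₂ x₃ x₄ Y x₃x₄Y) (independent i₄ i₂ i₃ (λ ()) (λ ()) (λ ()))
        (x₂-join-through-W⇒Y x₄ x₂x₄W)))

    -- W ∈ x₃x₄ forces W = Y (both lie on x₃x₄ and on x₂Y), then Y ∈ ℓ forces Y = X₅.
    x₃x₄∌W : ¬ det x₃ x₄ W ≡0
    x₃x₄∌W x₃x₄W = X₅-free i₃ i₄ (s≤s (s≤s (s≤s z≤n))) x₃x₄X₅
      where
        x₃YW : det x₃ Y W ≡0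
        x₃YW = on-join⇒collinear (cross x₁ x₄) x₃ x₄ Y W (X-point i₄) (det-≡0-repeat₂ x₁ x₄)
          (independent i₁ i₄ i₃ (λ ()) (λ ()) (λ ())) x₃x₄Y x₃x₄W
        ℓ∋Y : dot ℓ Y ≡0
        ℓ∋Y = meet-of-joins ℓ Y W x₂ x₃ W-point (det-≡0-rotate x₂ Y W x₂YW) (det-≡0-rotate x₃ Y W x₃YW)
          (λ Yx₂x₃ → x₂x₃∌Y (det-≡0-rotate Y x₂ x₃ Yx₂x₃)) ℓ∋W
        X₅Yx₃ : det X₅ Y x₃ ≡0
        X₅Yx₃ = collinear-off-line ℓ X₅ Y x₁ x₃ ℓ∋X₅ ℓ∋Y (ℓ∌X i₁) (det-≡0-rotate x₁ X₅ Y x₁X₅Y)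
        x₃x₄X₅ : det x₃ x₄ X₅ ≡0
        x₃x₄X₅ = meet-of-joins (cross x₃ x₄) X₅ Y x₁ x₃ Y-point (det-≡0-rotate x₁ X₅ Y x₁X₅Y) X₅Yx₃
          (λ X₅x₁x₃ → X₅-free i₁ i₃ (s≤s z≤n) (det-≡0-rotate X₅ x₁ x₃ X₅x₁x₃)) x₃x₄Y

    no-pair-through-W : ∀ i j → i < j → ¬ det (X i) (X j) W ≡0
    no-pair-through-W zero (suc zero) _ = x₁x₂∌W
    no-pair-through-W zero (suc (suc zero)) _ = x₁x₃∌W
    no-pair-through-W zero (suc (suc (suc zero))) _ = x₁x₄∌W
    no-pair-through-W (suc zero) (suc (suc zero)) _ = x₂x₃∌W
    no-pair-through-W (suc zero) (suc (suc (suc zero))) _ = x₂x₄∌W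
    no-pair-through-W (suc (suc zero)) (suc (suc (suc zero))) _ = x₃x₄∌W
    no-pair-through-W zero zero ()
    no-pair-through-W (suc zero) zero ()
    no-pair-through-W (suc zero) (suc zero) (s≤s ())
    no-pair-through-W (suc (suc zero)) zero ()
    no-pair-through-W (suc (suc zero)) (suc zero) (s≤s ())
    no-pair-through-W (suc (suc zero)) (suc (suc zero)) (s≤s (s≤s ()))
    no-pair-through-W (suc (suc (suc zero))) zero ()
    no-pair-through-W (suc (suc (suc zero))) (suc zero) (s≤s ())
    no-pair-through-W (suc (suc (suc zero))) (suc (suc zero)) (s≤s (s≤s ()))
    no-pair-through-W (suc (suc (suc zero))) (suc (suc (suc zero))) (s≤s (s≤s (s≤s ())))

lemma4p4 : (p : ℕ) → Prime p →
    (X : Fin 4 → Triple) → (X₅ X₆ ℓ : Triple) →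
    ((i : Fin 4) → IsPoint p (X i)) → IsPoint p X₅ → IsPoint p X₆ → IsLine p ℓ →
    ((i j k : Fin 4) → i ≢ j → j ≢ k → i ≢ k → ¬ Collinear p (X i) (X j) (X k)) →
    OnLine p X₅ ℓ → OnLine p X₆ ℓ → ((i : Fin 4) → ¬ OnLine p (X i) ℓ) →
    (Y X₅′ Z X₆′ : Triple) →
    IsPoint p Y → Collinear p (X zero) X₅ Y → Collinear p (X (suc (suc zero))) (X (suc (suc (suc zero)))) Y →
    IsPoint p X₅′ → Collinear p (X (suc zero)) Y X₅′ → OnLine p X₅′ ℓ →
    IsPoint p Z → Collinear p (X (suc zero)) X₆ Z → Collinear p (X (suc (suc zero))) (X (suc (suc (suc zero)))) Z →
    IsPoint p X₆′ → Collinear p (X zero) Z X₆′ → OnLine p X₆′ ℓ →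
    ((i j : Fin 4) → i < j → ¬ Collinear p (X i) (X j) X₅) →
    ((i j : Fin 4) → i < j → ¬ Collinear p (X i) (X j) X₆) →
    Σ (Fin 4) (λ i → Σ (Fin 4) (λ j → i < j × (Collinear p (X i) (X j) X₅′ ⊎ Collinear p (X i) (X j) X₆′))) →
    ¬ SamePoint p X₅′ X₆′
lemma4p4 p p-prime X X₅ X₆ ℓ X-point _ _ _ X-independent ℓ∋X₅ _ ℓ∌X Y X₅′ Z X₆′
  Y-point x₁X₅Y x₃x₄Y X₅′-point x₂YX₅′ ℓ∋X₅′ Z-point x₂X₆Z x₃x₄Z _ x₁ZX₆′ _ X₅-free X₆-free
  (i , j , i<j , xᵢxⱼX′) X₅′≈X₆′ = no-pair-through-W i j i<j (collinear-with-X₅′ xᵢxⱼX′)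
  where
    open ModPrime p p-prime

    collinear-with-X₅′ : Collinear p (X i) (X j) X₅′ ⊎ Collinear p (X i) (X j) X₆′ → det (X i) (X j) X₅′ ≡0
    collinear-with-X₅′ (inj₁ xᵢxⱼX₅′) = collinear⇒det≡0 (X i) (X j) X₅′ xᵢxⱼX₅′
    collinear-with-X₅′ (inj₂ xᵢxⱼX₆′) =
      samePoint-incident (cross (X i) (X j)) X₅′ X₆′ X₅′≈X₆′ (collinear⇒det≡0 (X i) (X j) X₆′ xᵢxⱼX₆′)

    open Configuration X ℓ X₅ X₆ Y Z X₅′ X-point Y-point Z-point X₅′-point
      (λ i j k i≢j j≢k i≢k → det-≢0 (X i) (X j) (X k) (X-point i) (X-independent i j k i≢j j≢k i≢k))
      (λ i ℓ∋Xᵢ → ℓ∌X i (≡0⇒≡[p]0 ℓ∋Xᵢ)) (≡[p]0⇒≡0 ℓ∋X₅) (≡[p]0⇒≡0 ℓ∋X₅′)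
      (λ i j i<j → det-≢0 (X i) (X j) X₅ (X-point i) (X₅-free i j i<j))
      (λ i j i<j → det-≢0 (X i) (X j) X₆ (X-point i) (X₆-free i j i<j))
      (collinear⇒det≡0 _ _ _ x₁X₅Y) (collinear⇒det≡0 _ _ _ x₃x₄Y) (collinear⇒det≡0 _ _ _ x₂YX₅′)
      (collinear⇒det≡0 _ _ _ x₂X₆Z) (collinear⇒det≡0 _ _ _ x₃x₄Z)
      (samePoint-incident (cross (X zero) Z) X₅′ X₆′ X₅′≈X₆′ (collinear⇒det≡0 _ _ _ x₁ZX₆′))
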